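{- For any finite poset $\mathcal P$, $w^*(\mathcal P)\le h^*(\mathcal P)\,|\mathcal P|\le|\mathcal P|^2$.
   Context: For integers $h\le n$, $\binom{[n]}{\le h}$ denotes the induced subposet of the hypercube $Q_n$ (subsets of $[n]=\{1,\dots,n\}$ ordered by inclusion) consisting of all sets of size at most $h$. A poset contains an induced copy of $\mathcal P$ if it has a subset which, with the induced order, is isomorphic to $\mathcal P$. The cube-height $h^*(\mathcal P)$ is the minimum $h\in\mathbb N$ for which there exists $n\in\mathbb N$ such that $\binom{[n]}{\le h}$ contains an induced copy of $\mathcal P$. The cube-width $w^*(\mathcal P)$ is the minimum $w\in\mathbb N$ such that $\binom{[w]}{\le h^*(\mathcal P)}$ contains an induced copy of $\mathcal P$. -}

module Defs where

open import Level using (0ℓ)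
open import Data.Nat using (ℕ; _≤_)
open import Data.Fin using (Fin)
open import Data.Fin.Subset using (Subset; _⊆_; ∣_∣)
open import Data.Product using (Σ; _×_)
open import Relation.Binary.Core using (Rel)
open import Relation.Binary.Structures using (IsPartialOrder)
open import Relation.Binary.PropositionalEquality using (_≡_)
open import Function.Definitions using (Injective)
open import Function.Bundles using (_⇔_)

record FinPoset : Set₁ where
  field
    size  : ℕ
    _≼_   : Rel (Fin size) 0ℓ
    isPartialOrder : IsPartialOrder _≡_ _≼_

open FinPoset public

-- The layer poset binom([n], ≤ h) contains an induced copy of P:
-- an injective map f from P into subsets of [n] of size at most h
-- with  x ≼ y  ⇔  f x ⊆ f y.
record InducedCopy (P : FinPoset) (n h : ℕ) : Set where
  field
    f         : Fin (size P) → Subset n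
    small     : ∀ x → ∣ f x ∣ ≤ h
    injective : Injective _≡_ _≡_ f
    order     : ∀ x y → (_≼_ P x y ⇔ (f x ⊆ f y))

IsCubeHeight : FinPoset → ℕ → Set
IsCubeHeight P h =
  Σ ℕ (λ n → InducedCopy P n h) ×
  (∀ h′ n → InducedCopy P n h′ → h ≤ h′)

IsCubeWidth : FinPoset → ℕ → ℕ → Set
IsCubeWidth P h w =
  InducedCopy P w h × (∀ w′ → InducedCopy P w′ h → w ≤ w′)

-- The down-set map x ↦ {y ∣ y ≼ x} embeds P into the cube on |P| coordinates
-- using sets of size at most |P|, so h* ≤ |P|.  An induced copy of P in the
-- layers of height at most h uses at most h·|P| coordinates in total, and a
-- coordinate used by no set can be deleted without changing any inclusion,
-- so w* ≤ h·|P|.  Constructively the down-set map needs ≼ to be decidable;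
-- this is inherited from ⊆ through any induced copy of P.
module Submission where

open import Defs
open import Data.Nat using (ℕ; _≤_; _*_)
open import Data.Product using (_×_)

open import Data.Nat using (zero; suc; _+_; _<_; z≤n; s≤s; _≤?_)
open import Data.Nat.Properties
  using (≤-trans; ≤-reflexive; ≤-<-trans; +-mono-≤; +-monoʳ-≤; +-suc; *-comm; *-monoˡ-≤; ≰⇒>)
open import Data.Fin using (Fin; zero; suc)
open import Data.Fin.Subset using (Side; Subset; inside; outside; _∈_; _∉_; _⊆_; _∪_; ⋃; ∣_∣)
open import Data.Fin.Subset.Properties
  using (drop-∷-⊆; drop-not-there; out⊆; in⊆in; ⊆-trans; ⊆-reflexive; _⊆?_;
         p⊆p∪q; q⊆p∪q; ∣p∣≤n; ∣p∣≤∣x∷p∣; ∣⊥∣≡0)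
open import Data.Vec using (_∷_; []; here; there; tabulate; removeAt)
open import Data.Vec.Properties using (lookup∘tabulate; []=⇒lookup; lookup⇒[]=)
open import Data.List as List using (List)
open import Data.List.Properties using (length-tabulate)
open import Data.List.Membership.Propositional using () renaming (_∈_ to _∈ₗ_)
open import Data.List.Membership.Propositional.Properties using (∈-tabulate⁺)
open import Data.List.Relation.Unary.Any using (here; there)
open import Data.List.Relation.Unary.All using (All; []; _∷_)
open import Data.List.Relation.Unary.All.Properties using (tabulate⁺)
open import Data.Product using (∃; _,_)
open import Data.Bool.Properties using (T-≡)
open import Function using (_∘′_)
open import Function.Bundles using (_⇔_; mk⇔; Equivalence)
open import Function.Properties.Equivalence using () renaming (sym to ⇔-sym)
open import Relation.Binary.Definitions using (Decidable)
open import Relation.Binary.PropositionalEquality using (_≡_; refl; sym; trans; cong)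
open import Relation.Binary.Structures using (IsPartialOrder)
open import Relation.Nullary using (yes; no; contradiction)
import Relation.Nullary.Decidable as Dec

private
  variable
    n h : ℕ
    p : Subset n

∣p∪q∣≤∣p∣+∣q∣ : (p q : Subset n) → ∣ p ∪ q ∣ ≤ ∣ p ∣ + ∣ q ∣
∣p∪q∣≤∣p∣+∣q∣ []            []            = z≤n
∣p∪q∣≤∣p∣+∣q∣ (inside  ∷ p) (s ∷ q)       =
  s≤s (≤-trans (∣p∪q∣≤∣p∣+∣q∣ p q) (+-monoʳ-≤ ∣ p ∣ (∣p∣≤∣x∷p∣ s q)))
∣p∪q∣≤∣p∣+∣q∣ (outside ∷ p) (inside  ∷ q) =
  ≤-trans (s≤s (∣p∪q∣≤∣p∣+∣q∣ p q)) (≤-reflexive (sym (+-suc ∣ p ∣ ∣ q ∣)))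
∣p∪q∣≤∣p∣+∣q∣ (outside ∷ p) (outside ∷ q) = ∣p∪q∣≤∣p∣+∣q∣ p q

∣⋃ps∣≤length*h : {ps : List (Subset n)} → All (λ p → ∣ p ∣ ≤ h) ps →
                 ∣ ⋃ ps ∣ ≤ List.length ps * h
∣⋃ps∣≤length*h {n} []          = ≤-reflexive (∣⊥∣≡0 n)
∣⋃ps∣≤length*h {ps = p List.∷ ps} (p≤h ∷ ps≤h) =
  ≤-trans (∣p∪q∣≤∣p∣+∣q∣ p (⋃ ps)) (+-mono-≤ p≤h (∣⋃ps∣≤length*h ps≤h))

p⊆⋃ps : {ps : List (Subset n)} → p ∈ₗ ps → p ⊆ ⋃ ps
p⊆⋃ps {ps = q List.∷ ps} (here refl) = p⊆p∪q (⋃ ps)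
p⊆⋃ps {ps = q List.∷ ps} (there p∈ps) = ⊆-trans (p⊆⋃ps p∈ps) (q⊆p∪q q (⋃ ps))

∣p∣<n⇒∃∉ : (p : Subset n) → ∣ p ∣ < n → ∃ λ i → i ∉ p
∣p∣<n⇒∃∉ (outside ∷ p) _         = zero , λ ()
∣p∣<n⇒∃∉ (inside  ∷ p) (s≤s p<n) with ∣p∣<n⇒∃∉ p p<n
... | i , i∉p = suc i , λ { (there i∈p) → i∉p i∈p }

∈-tabulate⇔ : {g : Fin n → Side} {x : Fin n} → x ∈ tabulate g ⇔ g x ≡ inside
∈-tabulate⇔ {g = g} {x} = mk⇔
  (λ x∈ → trans (sym (lookup∘tabulate g x)) ([]=⇒lookup x∈))
  (λ gx≡ → lookup⇒[]= x (tabulate g) (trans (lookup∘tabulate g x) gx≡))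

∣removeAt∣≤ : (p : Subset (suc n)) (i : Fin (suc n)) → ∣ removeAt p i ∣ ≤ ∣ p ∣
∣removeAt∣≤ (s       ∷ p)         zero    = ∣p∣≤∣x∷p∣ s p
∣removeAt∣≤ (inside  ∷ p@(_ ∷ _)) (suc i) = s≤s (∣removeAt∣≤ p i)
∣removeAt∣≤ (outside ∷ p@(_ ∷ _)) (suc i) = ∣removeAt∣≤ p i

removeAt-⊆ : {p q : Subset (suc n)} (i : Fin (suc n)) → p ⊆ q → removeAt p i ⊆ removeAt q i
removeAt-⊆ {p = _       ∷ _}     {q = _ ∷ _}     zero    p⊆q  = drop-∷-⊆ p⊆q
removeAt-⊆ {p = outside ∷ _ ∷ _} {q = _ ∷ _ ∷ _} (suc i) op⊆q = out⊆ (removeAt-⊆ i (drop-∷-⊆ op⊆q))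
removeAt-⊆ {p = inside  ∷ _ ∷ _} {q = _ ∷ _ ∷ _} (suc i) ip⊆q with ip⊆q here
... | here = in⊆in (removeAt-⊆ i (drop-∷-⊆ ip⊆q))

removeAt-⊆⁻ : {p q : Subset (suc n)} (i : Fin (suc n)) →
              i ∉ p → removeAt p i ⊆ removeAt q i → p ⊆ q
removeAt-⊆⁻ {p = inside  ∷ _}     {q = _ ∷ _}     zero    i∉p _    = contradiction here i∉p
removeAt-⊆⁻ {p = outside ∷ _}     {q = _ ∷ _}     zero    _   p⊆q  = out⊆ p⊆q
removeAt-⊆⁻ {p = outside ∷ _ ∷ _} {q = _ ∷ _ ∷ _} (suc i) i∉p op⊆q =
  out⊆ (removeAt-⊆⁻ i (drop-not-there i∉p) (drop-∷-⊆ op⊆q))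
removeAt-⊆⁻ {p = inside  ∷ _ ∷ _} {q = _ ∷ _ ∷ _} (suc i) i∉p ip⊆q with ip⊆q here
... | here = in⊆in (removeAt-⊆⁻ i (drop-not-there i∉p) (drop-∷-⊆ ip⊆q))

module _ (P : FinPoset) where
  open IsPartialOrder (isPartialOrder P) using (antisym) renaming (refl to ≼-refl; trans to ≼-trans)
  open Equivalence using (to; from)

  inducedCopy : (f : Fin (size P) → Subset n) → (∀ x → ∣ f x ∣ ≤ h) →
                (∀ x y → _≼_ P x y ⇔ f x ⊆ f y) → InducedCopy P n h
  inducedCopy f small order = record
    { f         = f
    ; small     = small
    ; injective = λ {x} {y} fx≡fy →
        antisym (from (order x y) (⊆-reflexive fx≡fy)) (from (order y x) (⊆-reflexive (sym fx≡fy)))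
    ; order     = order
    }

  ≼-decidable : InducedCopy P n h → Decidable (_≼_ P)
  ≼-decidable C x y = Dec.map (⇔-sym (order x y)) (f x ⊆? f y)
    where open InducedCopy C

  downSetCopy : Decidable (_≼_ P) → InducedCopy P (size P) (size P)
  downSetCopy _≼?_ = inducedCopy ↓ (λ x → ∣p∣≤n (↓ x)) ↓-order
    where
    ↓ : Fin (size P) → Subset (size P)
    ↓ x = tabulate (λ y → Dec.isYes (y ≼? x))

    ∈↓⇔ : ∀ {x y} → y ∈ ↓ x ⇔ _≼_ P y x
    ∈↓⇔ {x} {y} = mk⇔
      (λ y∈↓x → Dec.toWitness (from T-≡ (to ∈-tabulate⇔ y∈↓x)))
      (λ y≼x → from ∈-tabulate⇔ (to T-≡ (Dec.fromWitness y≼x)))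

    ↓-order : ∀ x y → _≼_ P x y ⇔ ↓ x ⊆ ↓ y
    ↓-order x y = mk⇔
      (λ x≼y {_} z∈↓x → from ∈↓⇔ (≼-trans (to ∈↓⇔ z∈↓x) x≼y))
      (λ ↓x⊆↓y → to ∈↓⇔ (↓x⊆↓y (from ∈↓⇔ ≼-refl)))

  deleteCoordinate : (C : InducedCopy P (suc n) h) (i : Fin (suc n)) →
                     (∀ x → i ∉ InducedCopy.f C x) → InducedCopy P n h
  deleteCoordinate C i unused = inducedCopy
    (λ x → removeAt (f x) i)
    (λ x → ≤-trans (∣removeAt∣≤ (f x) i) (small x))
    (λ x y → mk⇔ (removeAt-⊆ i ∘′ to (order x y))
                 (from (order x y) ∘′ removeAt-⊆⁻ i (unused x)))
    where
    open InducedCopy C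

  unusedCoordinate : (C : InducedCopy P n h) → h * size P < n →
                     ∃ λ i → ∀ x → i ∉ InducedCopy.f C x
  unusedCoordinate {n} {h} C h*s<n =
    let i , i∉⋃ = ∣p∣<n⇒∃∉ (⋃ images) ∣⋃images∣<n
    in  i , λ x i∈fx → i∉⋃ (p⊆⋃ps (∈-tabulate⁺ x) i∈fx)
    where
    open InducedCopy C
    images : List (Subset n)
    images = List.tabulate f

    ∣⋃images∣<n : ∣ ⋃ images ∣ < n
    ∣⋃images∣<n = ≤-<-trans (∣⋃ps∣≤length*h (tabulate⁺ small))
      (≤-<-trans (≤-reflexive (trans (cong (_* h) (length-tabulate f)) (*-comm (size P) h))) h*s<n)

  narrowCopy : InducedCopy P n h → ∃ λ m → m ≤ h * size P × InducedCopy P m h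
  narrowCopy {zero}      C = zero , z≤n , C
  narrowCopy {suc n} {h} C with suc n ≤? h * size P
  ... | yes n≤h*s = suc n , n≤h*s , C
  ... | no  n≰h*s =
    let i , unused = unusedCoordinate C (≰⇒> n≰h*s)
    in  narrowCopy (deleteCoordinate C i unused)

corollary2p4 : (P : FinPoset) (h w : ℕ) →
    IsCubeHeight P h → IsCubeWidth P h w →
    (w ≤ h * size P) × (h * size P ≤ size P * size P)
corollary2p4 P h w ((_ , C) , h-minimal) (Cw , w-minimal) =
  let m , m≤h*s , Cm = narrowCopy P Cw
  in  ≤-trans (w-minimal m Cm) m≤h*s
    , *-monoˡ-≤ (size P) (h-minimal (size P) (size P) (downSetCopy P (≼-decidable P C)))
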